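{- Let $\Gamma_1$ and $\Gamma_2$ be simple digraphs. Then $\operatorname{th}(\Gamma_1\cup\Gamma_2)=\operatorname{th}(\Gamma_1^T\cup\Gamma_2)$, where $\cup$ denotes disjoint union.
   Context: A simple digraph has a finite vertex set and no loops or parallel arcs (opposite arcs allowed). The transpose $\Gamma^T$ is obtained by reversing every arc of $\Gamma$. $v$ is an out-neighbor of $u$ if $(u,v)$ is an arc. Zero forcing: vertices are blue or white; a blue vertex $u$ with exactly one white out-neighbor $w$ may force $w$ ($u\to w$), turning it blue. A set $\mathcal F$ of forces is a set of forces of $B\subseteq V(\Gamma)$ if, starting with exactly $B$ blue, the forces in $\mathcal F$ can be validly performed in some order after which no further force is possible. Put $\mathcal F^{[0]}=B$ and $\mathcal F^{[t+1]}=\mathcal F^{[t]}\cup\{w\notin\mathcal F^{[t]}:(u\to w)\in\mathcal F,\ u\in\mathcal F^{[t]},\ w$ the only out-neighbor of $u$ outside $\mathcal F^{[t]}\}$; $\operatorname{pt}(\Gamma;\mathcal F)$ is the least $t$ with $\mathcal F^{[t]}=V(\Gamma)$ ($\infty$ if none); $\operatorname{pt}(\Gamma;B)=\min_{\mathcal F}\operatorname{pt}(\Gamma;\mathcal F)$. The throttling number is $\operatorname{th}(\Gamma)=\min_{B\subseteq V(\Gamma)}(|B|+\operatorname{pt}(\Gamma;B))$. -}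

module Defs where

open import Data.Nat using (ℕ; _+_; _≤_; _<_)
open import Data.Bool using (Bool; true; false; _∧_; _∨_; not)
open import Data.Fin using (Fin; splitAt; _≟_)
open import Data.Fin.Subset using (Subset; ∣_∣; ⊤; _∪_; ⁅_⁆)
open import Data.Sum using (_⊎_; inj₁; inj₂)
open import Data.Product using (Σ; _×_; _,_; ∃)
open import Data.List using (List; []; _∷_; allFin)
open import Data.Bool.ListAction using (all; any)
open import Data.List.Membership.Propositional using (_∈_)
open import Data.Vec using (lookup; tabulate)
open import Relation.Nullary.Decidable using (⌊_⌋)
open import Relation.Binary.PropositionalEquality using (_≡_; refl)
open import Function.Bundles using (_⇔_)

-- A simple digraph on vertex set Fin n: an arc relation without loops
-- (opposite arcs allowed; parallel arcs impossible since arcs form a relation).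
record Digraph : Set where
  field
    n        : ℕ
    arc      : Fin n → Fin n → Bool
    loopless : ∀ v → arc v v ≡ false
open Digraph public

_ᵀ : Digraph → Digraph
Γ ᵀ = record { n = n Γ ; arc = λ u v → arc Γ v u ; loopless = loopless Γ }

-- Disjoint union: vertices of Γ₁ are the first n Γ₁ elements of Fin (n Γ₁ + n Γ₂).
unionArc : ∀ {m k} → (Fin m → Fin m → Bool) → (Fin k → Fin k → Bool)
         → Fin (m + k) → Fin (m + k) → Bool
unionArc {m} a b i j with splitAt m i | splitAt m j
... | inj₁ x | inj₁ y = a x y
... | inj₂ x | inj₂ y = b x y
... | inj₁ _ | inj₂ _ = false
... | inj₂ _ | inj₁ _ = false

unionLoopless : ∀ {m k} (a : Fin m → Fin m → Bool) (b : Fin k → Fin k → Bool)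
              → (∀ v → a v v ≡ false) → (∀ v → b v v ≡ false)
              → ∀ v → unionArc a b v v ≡ false
unionLoopless {m} a b la lb v with splitAt m v
... | inj₁ x = la x
... | inj₂ x = lb x

_⊔_ : Digraph → Digraph → Digraph
Γ₁ ⊔ Γ₂ = record
  { n = n Γ₁ + n Γ₂
  ; arc = unionArc (arc Γ₁) (arc Γ₂)
  ; loopless = unionLoopless (arc Γ₁) (arc Γ₂) (loopless Γ₁) (loopless Γ₂) }

module _ (Γ : Digraph) where

  V : Set
  V = Fin (n Γ)

  -- w is the only out-neighbour of u that is white (outside S)
  onlyWhite : Subset (n Γ) → V → V → Bool
  onlyWhite S u w =
    arc Γ u w ∧ not (lookup S w)
    ∧ all (λ x → not (arc Γ u x ∧ not (lookup S x)) ∨ ⌊ x ≟ w ⌋) (allFin (n Γ))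

  data ValidSeq : Subset (n Γ) → List (V × V) → Subset (n Γ) → Set where
    done : ∀ {S} → ValidSeq S [] S
    step : ∀ {S u w L T} → lookup S u ≡ true → onlyWhite S u w ≡ true
         → ValidSeq (S ∪ ⁅ w ⁆) L T → ValidSeq S ((u , w) ∷ L) T

  Stuck : Subset (n Γ) → Set
  Stuck S = ∀ u w → lookup S u ≡ true → onlyWhite S u w ≡ false

  IsForcesOf : Subset (n Γ) → (V → V → Bool) → Set
  IsForcesOf B F = Σ (List (V × V)) λ L → Σ (Subset (n Γ)) λ T →
    ValidSeq B L T × Stuck T × (∀ u w → ((u , w) ∈ L) ⇔ (F u w ≡ true))

  iter : Subset (n Γ) → (V → V → Bool) → ℕ → Subset (n Γ)
  iter B F ℕ.zero = B
  iter B F (ℕ.suc t) = tabulate λ w → lookup S w ∨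
      any (λ u → lookup S u ∧ F u w ∧ onlyWhite S u w) (allFin (n Γ))
    where S = iter B F t

  -- th(Γ) = k, i.e. k = min over B, over sets of forces F of B, over t with
  -- F^[t] = V, of |B| + t  (min of |B| + pt(Γ;B) with pt(Γ;B) = min_F pt(Γ;F),
  -- pt(Γ;F) = least t with F^[t] = V; infinite values never attain the min).
  IsThrottling : ℕ → Set
  IsThrottling k =
    (Σ (Subset (n Γ)) λ B → Σ (V → V → Bool) λ F → Σ ℕ λ t →
       IsForcesOf B F × iter B F t ≡ ⊤ × ∣ B ∣ + t ≡ k)
    × (∀ B F t → IsForcesOf B F → iter B F t ≡ ⊤ → k ≤ ∣ B ∣ + t)

module Submission where

-- The proof works with schedules: a time τ v ≤ t for every vertex and, for
-- every vertex with τ v > 0, a parent u with τ u < τ v, an arc u → v, and all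
-- other out-neighbours of u of time below τ v.  The initial set of a schedule
-- is {v | τ v = 0}.  Module Transpose runs every forcing chain of Γ₁
-- backwards in time (u ↦ t + 1 − τ(child of u)); the horizon is unchanged and
-- "left vertex ↦ its parent" injects the late vertices of the old schedule
-- into those of the new one, so the initial set does not grow.  As
-- (Γ₁ᵀ)ᵀ = Γ₁, the resulting inequality holds in both directions.

open import Defs
open import Data.Nat using (ℕ; zero; suc; pred; _+_; _∸_; _≤_; _<_; z≤n; s≤s; s≤s⁻¹; _≡ᵇ_; >-nonZero)
import Data.Nat.Properties as ℕ
open import Data.Nat.Induction using (<-rec)
open import Data.Bool using (Bool; true; false; _∧_; _∨_; not; if_then_else_; T)
open import Data.Bool.Properties using (T-≡; ⇔→≡)
import Data.Bool.Properties as Bool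
open import Data.Fin using (Fin; zero; suc; splitAt) renaming (_≟_ to _≟ᶠ_)
open import Data.Fin.Subset using (Subset; ∣_∣; ⊤; ⁅_⁆; _∪_; ∁; _-_; inside)
import Data.Fin.Subset as Subset
open import Data.Fin.Subset.Properties
  using (anySubset?; ∣⊤∣≡n; x∈∁p⇒x∉p; x∉p⇒x∈∁p; ∣p∣≤n; ∣∁p∣≡n∸∣p∣; nonempty?; Empty-unique; ∣⊥∣≡0;
         x∈⁅x⁆; x∈⁅y⁆⇒x≡y; p─q⊆p; x∈p∧x≢y⇒x∈p-y; x∈p⇒∣p-x∣<∣p∣; p─⊥≡p)
open import Data.Fin.Properties using (any?)
open import Data.Sum using (_⊎_; inj₁; inj₂)
open import Data.Product using (Σ; _×_; _,_; proj₁; proj₂; ∃)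
open import Data.List using (List; []; _∷_; allFin; _++_; map; filter)
open import Data.Bool.ListAction using (all; any)
open import Data.List.Membership.Propositional using (_∈_)
open import Data.List.Membership.Propositional.Properties
  using (∈-allFin; ∈-filter⁺; ∈-filter⁻; ∈-map⁺; ∈-map⁻; ∈-++⁺ˡ; ∈-++⁺ʳ; ∈-++⁻)
open import Data.List.Relation.Unary.Any using (here; there; satisfied)
import Data.List.Relation.Unary.Any as Any
import Data.List.Relation.Unary.All as All
open import Data.List.Relation.Unary.All.Properties using (all⁺; all⁻)
open import Data.List.Relation.Unary.Any.Properties using (any⁺; any⁻)
open import Data.List.Relation.Unary.AllPairs using (_∷_)
open import Data.List.Relation.Unary.Unique.Propositional using (Unique)
import Data.List.Relation.Unary.Unique.Propositional.Properties as Unique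
open import Data.Vec using (lookup; tabulate; _∷_; here; there)
open import Data.Vec.Properties
  using (lookup∘tabulate; tabulate∘lookup; tabulate-cong; lookup-zipWith;
         lookup-replicate; []=⇒lookup; lookup⇒[]=)
import Data.Vec.Properties as Vec
open import Relation.Nullary using (Dec; yes; no; contradiction)
open import Relation.Nullary.Decidable using (⌊_⌋; map′; _×-dec_; toWitness; fromWitness)
open import Relation.Binary.PropositionalEquality
  using (_≡_; _≢_; refl; sym; trans; cong; subst; subst₂)
open import Function.Bundles using (_⇔_; mk⇔; Equivalence)
open import Function using (_∘_)

T⇒≡ : ∀ {b} → T b → b ≡ true
T⇒≡ = Equivalence.to T-≡

≡⇒T : ∀ {b} → b ≡ true → T b
≡⇒T = Equivalence.from T-≡

true-or-false : ∀ b → b ≡ true ⊎ b ≡ false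
true-or-false true  = inj₁ refl
true-or-false false = inj₂ refl

true≢false : ∀ {b} → b ≡ true → b ≢ false
true≢false refl ()

∧-true⁻ : ∀ {a b} → a ∧ b ≡ true → a ≡ true × b ≡ true
∧-true⁻ {true} b≡true = refl , b≡true

∧-true⁺ : ∀ {a b} → a ≡ true → b ≡ true → a ∧ b ≡ true
∧-true⁺ refl refl = refl

∨-true⁻ : ∀ {a b} → a ∨ b ≡ true → a ≡ true ⊎ b ≡ true
∨-true⁻ {true}  _        = inj₁ refl
∨-true⁻ {false} b≡true   = inj₂ b≡true

∨-trueˡ : ∀ {a} b → a ≡ true → a ∨ b ≡ true
∨-trueˡ b refl = refl

∨-trueʳ : ∀ a {b} → b ≡ true → a ∨ b ≡ true
∨-trueʳ true  _      = refl
∨-trueʳ false b≡true = b≡true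

not-true⁻ : ∀ {a} → not a ≡ true → a ≡ false
not-true⁻ {false} _ = refl

not-true⁺ : ∀ {a} → a ≡ false → not a ≡ true
not-true⁺ refl = refl

-- `not (a ∧ not l) ∨ d` is the Boolean form of "a and not l imply d".
implies⁻ : ∀ a l d → not (a ∧ not l) ∨ d ≡ true → a ≡ true → l ≡ false → d ≡ true
implies⁻ true false d d≡true refl refl = d≡true

implies⁺ : ∀ a l d → (a ≡ true → l ≡ false → d ≡ true) → not (a ∧ not l) ∨ d ≡ true
implies⁺ true  false d d≡true = d≡true refl refl
implies⁺ true  true  d _      = refl
implies⁺ false l     d _      = refl

⌊⌋-true⇔ : ∀ {P : Set} (d : Dec P) → ⌊ d ⌋ ≡ true ⇔ P
⌊⌋-true⇔ d = mk⇔ (λ h → toWitness (≡⇒T h)) (λ p → T⇒≡ (fromWitness p))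

all-true⁻ : ∀ {A : Set} (p : A → Bool) xs → all p xs ≡ true → ∀ {x} → x ∈ xs → p x ≡ true
all-true⁻ p xs h x∈xs = T⇒≡ (All.lookup (all⁺ p xs (≡⇒T h)) x∈xs)

all-true⁺ : ∀ {A : Set} (p : A → Bool) xs → (∀ x → p x ≡ true) → all p xs ≡ true
all-true⁺ p xs h = T⇒≡ (all⁻ p {xs = xs} (All.tabulate λ {x} _ → ≡⇒T (h x)))

any-true⁻ : ∀ {A : Set} (p : A → Bool) xs → any p xs ≡ true → Σ A λ x → p x ≡ true
any-true⁻ p xs h with satisfied (any⁻ p xs (≡⇒T h))
... | x , px = x , T⇒≡ px

any-true⁺ : ∀ {A : Set} (p : A → Bool) {xs x} → x ∈ xs → p x ≡ true → any p xs ≡ true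
any-true⁺ p x∈xs px = T⇒≡ (any⁺ p (Any.map (λ { refl → ≡⇒T px }) x∈xs))

Least : (ℕ → Set) → Set
Least P = Σ ℕ λ k → P k × (∀ j → P j → k ≤ j)

-- Only the specification of the least witness is ever used, so its search is
-- kept abstract (unfolding it during type checking would run the search).
abstract
  least : ∀ {P : ℕ → Set} → (∀ k → Dec (P k)) → ∀ M → P M → Least P
  least {P} P? = <-rec (λ M → P M → Least P) search
    where
    search : ∀ M → (∀ {j} → j < M → P j → Least P) → P M → Least P
    search M below pM with ℕ.anyUpTo? P? M
    ... | yes (j , j<M , pj) = below j<M pj
    ... | no none            = M , pM , λ j pj → ℕ.≮⇒≥ λ j<M → none (j , j<M , pj)

subset-ext : ∀ {N} (S S′ : Subset N) → (∀ x → lookup S x ≡ lookup S′ x) → S ≡ S′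
subset-ext S S′ same = trans (sym (tabulate∘lookup S)) (trans (tabulate-cong same) (tabulate∘lookup S′))

lookup-⊤ : ∀ {N} (x : Fin N) → lookup ⊤ x ≡ true
lookup-⊤ x = lookup-replicate x inside

full⇒⊤ : ∀ {N} (S : Subset N) → (∀ x → lookup S x ≡ true) → S ≡ ⊤
full⇒⊤ S full = subset-ext S ⊤ λ x → trans (full x) (sym (lookup-⊤ x))

⊤⇒full : ∀ {N} {S : Subset N} → S ≡ ⊤ → ∀ x → lookup S x ≡ true
⊤⇒full refl = lookup-⊤

∪⁅⁆⁻ : ∀ {N} (S : Subset N) w x → lookup (S ∪ ⁅ w ⁆) x ≡ true → lookup S x ≡ true ⊎ x ≡ w
∪⁅⁆⁻ S w x h with ∨-true⁻ (trans (sym (lookup-zipWith _∨_ x S ⁅ w ⁆)) h)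
... | inj₁ x∈S  = inj₁ x∈S
... | inj₂ x∈⁅w⁆ = inj₂ (x∈⁅y⁆⇒x≡y w (lookup⇒[]= x ⁅ w ⁆ x∈⁅w⁆))

∪⁅⁆-old : ∀ {N} (S : Subset N) w x → lookup S x ≡ true → lookup (S ∪ ⁅ w ⁆) x ≡ true
∪⁅⁆-old S w x x∈S = trans (lookup-zipWith _∨_ x S ⁅ w ⁆) (∨-trueˡ _ x∈S)

∪⁅⁆-new : ∀ {N} (S : Subset N) w → lookup (S ∪ ⁅ w ⁆) w ≡ true
∪⁅⁆-new S w = trans (lookup-zipWith _∨_ w S ⁅ w ⁆) (∨-trueʳ (lookup S w) ([]=⇒lookup (x∈⁅x⁆ w)))

addAll : ∀ {N} → Subset N → List (Fin N) → Subset N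
addAll S []       = S
addAll S (w ∷ ws) = addAll (S ∪ ⁅ w ⁆) ws

addAll⁻ : ∀ {N} (S : Subset N) ws x → lookup (addAll S ws) x ≡ true → lookup S x ≡ true ⊎ x ∈ ws
addAll⁻ S []       x x∈S = inj₁ x∈S
addAll⁻ S (w ∷ ws) x h with addAll⁻ (S ∪ ⁅ w ⁆) ws x h
... | inj₂ x∈ws = inj₂ (there x∈ws)
... | inj₁ x∈S′ with ∪⁅⁆⁻ S w x x∈S′
...   | inj₁ x∈S = inj₁ x∈S
...   | inj₂ refl = inj₂ (here refl)

addAll-old : ∀ {N} (S : Subset N) ws x → lookup S x ≡ true → lookup (addAll S ws) x ≡ true
addAll-old S []       x x∈S = x∈S
addAll-old S (w ∷ ws) x x∈S = addAll-old (S ∪ ⁅ w ⁆) ws x (∪⁅⁆-old S w x x∈S)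

addAll-new : ∀ {N} (S : Subset N) ws x → x ∈ ws → lookup (addAll S ws) x ≡ true
addAll-new S (w ∷ ws) x (here refl) = addAll-old (S ∪ ⁅ w ⁆) ws x (∪⁅⁆-new S w)
addAll-new S (w ∷ ws) x (there x∈ws) = addAll-new (S ∪ ⁅ w ⁆) ws x x∈ws

-- Counting.  A map that is injective on S and sends S into T shows |S| ≤ |T|;
-- the proof removes one element x from S and its image f x from T.

∣p∣≤1+∣p-x∣ : ∀ {N} (p : Subset N) x → ∣ p ∣ ≤ suc ∣ p - x ∣
∣p∣≤1+∣p-x∣ (true  ∷ p) zero    = s≤s (ℕ.≤-reflexive (cong ∣_∣ (sym (p─⊥≡p p))))
∣p∣≤1+∣p-x∣ (false ∷ p) zero    = ℕ.m≤n⇒m≤1+n (ℕ.≤-reflexive (cong ∣_∣ (sym (p─⊥≡p p))))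
∣p∣≤1+∣p-x∣ (true  ∷ p) (suc x) = s≤s (∣p∣≤1+∣p-x∣ p x)
∣p∣≤1+∣p-x∣ (false ∷ p) (suc x) = ∣p∣≤1+∣p-x∣ p x

x∉p-x : ∀ {N} (p : Subset N) x → x Subset.∉ p - x
x∉p-x (_ ∷ p) zero    ()
x∉p-x (_ ∷ p) (suc x) (there x∈p-x) = x∉p-x p x x∈p-x

injection-≤ : ∀ {N} (S T : Subset N) (f : Fin N → Fin N) →
              (∀ x → x Subset.∈ S → f x Subset.∈ T) →
              (∀ x y → x Subset.∈ S → y Subset.∈ S → f x ≡ f y → x ≡ y) → ∣ S ∣ ≤ ∣ T ∣
injection-≤ {N} S T f = bounded N S T (∣p∣≤n S)
  where
  bounded : ∀ k S T → ∣ S ∣ ≤ k → (∀ x → x Subset.∈ S → f x Subset.∈ T) →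
            (∀ x y → x Subset.∈ S → y Subset.∈ S → f x ≡ f y → x ≡ y) → ∣ S ∣ ≤ ∣ T ∣
  bounded zero S T ∣S∣≤0 _ _ = subst (_≤ ∣ T ∣) (sym (ℕ.n≤0⇒n≡0 ∣S∣≤0)) z≤n
  bounded (suc k) S T ∣S∣≤k+1 into injective with nonempty? S
  ... | no empty = subst (_≤ ∣ T ∣) (sym (trans (cong ∣_∣ (Empty-unique empty)) (∣⊥∣≡0 N))) z≤n
  ... | yes (x , x∈S) = begin
      ∣ S ∣               ≤⟨ ∣p∣≤1+∣p-x∣ S x ⟩
      suc ∣ S - x ∣       ≤⟨ s≤s rest ⟩
      suc ∣ T - f x ∣     ≤⟨ x∈p⇒∣p-x∣<∣p∣ (into x x∈S) ⟩
      ∣ T ∣               ∎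
    where
    open ℕ.≤-Reasoning
    in-S : ∀ {y} → y Subset.∈ S - x → y Subset.∈ S
    in-S = p─q⊆p S ⁅ x ⁆
    into′ : ∀ y → y Subset.∈ S - x → f y Subset.∈ T - f x
    into′ y y∈S-x = x∈p∧x≢y⇒x∈p-y (into y (in-S y∈S-x)) λ fy≡fx →
      x∉p-x S x (subst (Subset._∈ S - x) (injective y x (in-S y∈S-x) x∈S fy≡fx) y∈S-x)
    rest : ∣ S - x ∣ ≤ ∣ T - f x ∣
    rest = bounded k (S - x) (T - f x) (s≤s⁻¹ (ℕ.≤-trans (x∈p⇒∣p-x∣<∣p∣ x∈S) ∣S∣≤k+1)) into′
             λ y z y∈ z∈ → injective y z (in-S y∈) (in-S z∈)

initial : ∀ {N} → (Fin N → ℕ) → Subset N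
initial τ = tabulate λ v → τ v ≡ᵇ 0

initial⇔ : ∀ {N} (τ : Fin N → ℕ) v → lookup (initial τ) v ≡ true ⇔ τ v ≡ 0
initial⇔ τ v rewrite lookup∘tabulate (λ v → τ v ≡ᵇ 0) v with τ v
... | zero  = mk⇔ (λ _ → refl) (λ _ → refl)
... | suc _ = mk⇔ (λ ()) (λ ())

late⇔ : ∀ {N} (τ : Fin N → ℕ) x → x Subset.∈ ∁ (initial τ) ⇔ 0 < τ x
late⇔ τ x = mk⇔
  (λ x-late → ℕ.n≢0⇒n>0 λ τx≡0 →
    x∈∁p⇒x∉p x-late (lookup⇒[]= x _ (Equivalence.from (initial⇔ τ x) τx≡0)))
  (λ τx>0 → x∉p⇒x∈∁p λ x-initial →
    ℕ.n>0⇒n≢0 τx>0 (Equivalence.to (initial⇔ τ x) ([]=⇒lookup x-initial)))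

fewer-initial : ∀ {N} (τ τ′ : Fin N → ℕ) (f : Fin N → Fin N) →
                (∀ x → 0 < τ x → 0 < τ′ (f x)) →
                (∀ x y → 0 < τ x → 0 < τ y → f x ≡ f y → x ≡ y) →
                ∣ initial τ′ ∣ ≤ ∣ initial τ ∣
fewer-initial {N} τ τ′ f into injective = begin
  ∣ initial τ′ ∣              ≡⟨ ℕ.m∸[m∸n]≡n (∣p∣≤n (initial τ′)) ⟨
  N ∸ (N ∸ ∣ initial τ′ ∣)    ≤⟨ ℕ.∸-monoʳ-≤ N late≤late′ ⟩
  N ∸ (N ∸ ∣ initial τ ∣)     ≡⟨ ℕ.m∸[m∸n]≡n (∣p∣≤n (initial τ)) ⟩
  ∣ initial τ ∣               ∎
  where
  open ℕ.≤-Reasoning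
  late : ∀ ρ x → x Subset.∈ ∁ (initial ρ) → 0 < ρ x
  late ρ x = Equivalence.to (late⇔ ρ x)
  late≤late′ : N ∸ ∣ initial τ ∣ ≤ N ∸ ∣ initial τ′ ∣
  late≤late′ = subst₂ _≤_ (∣∁p∣≡n∸∣p∣ (initial τ)) (∣∁p∣≡n∸∣p∣ (initial τ′))
    (injection-≤ (∁ (initial τ)) (∁ (initial τ′)) f
      (λ x x-late → Equivalence.from (late⇔ τ′ (f x)) (into x (late τ x x-late)))
      λ x y x-late y-late → injective x y (late τ x x-late) (late τ y y-late))

module Forcing (Γ : Digraph) where

  OnlyWhite : Subset (n Γ) → V Γ → V Γ → Set
  OnlyWhite S u w = arc Γ u w ≡ true × lookup S w ≡ false
                  × (∀ x → arc Γ u x ≡ true → lookup S x ≡ false → x ≡ w)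

  onlyWhite⇒ : ∀ S u w → onlyWhite Γ S u w ≡ true → OnlyWhite S u w
  onlyWhite⇒ S u w h with ∧-true⁻ h
  ... | arc-uw , rest with ∧-true⁻ rest
  ... | w-white , others = arc-uw , not-true⁻ w-white , λ x arc-ux x-white →
        Equivalence.to (⌊⌋-true⇔ (x ≟ᶠ w)) (implies⁻ (arc Γ u x) (lookup S x) _
                    (all-true⁻ _ (allFin (n Γ)) others (∈-allFin x)) arc-ux x-white)

  ⇒onlyWhite : ∀ S u w → OnlyWhite S u w → onlyWhite Γ S u w ≡ true
  ⇒onlyWhite S u w (arc-uw , w-white , others) =
    ∧-true⁺ arc-uw (∧-true⁺ (not-true⁺ w-white) (all-true⁺ _ (allFin (n Γ)) λ x →
      implies⁺ (arc Γ u x) (lookup S x) _ λ arc-ux x-white →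
        Equivalence.from (⌊⌋-true⇔ (x ≟ᶠ w)) (others x arc-ux x-white)))

  stuck-⊤ : Stuck Γ ⊤
  stuck-⊤ u w _ with true-or-false (onlyWhite Γ ⊤ u w)
  ... | inj₂ no-force = no-force
  ... | inj₁ force    = contradiction (proj₁ (proj₂ (onlyWhite⇒ ⊤ u w force))) (true≢false (lookup-⊤ w))

  iter-suc⁻ : ∀ B F t w → lookup (iter Γ B F (suc t)) w ≡ true →
              lookup (iter Γ B F t) w ≡ true ⊎
              Σ (V Γ) λ u → lookup (iter Γ B F t) u ≡ true × F u w ≡ true × OnlyWhite (iter Γ B F t) u w
  iter-suc⁻ B F t w h with ∨-true⁻ (trans (sym (lookup∘tabulate _ w)) h)
  ... | inj₁ blue   = inj₁ blue
  ... | inj₂ forced with any-true⁻ _ (allFin (n Γ)) forced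
  ... | u , force with ∧-true⁻ force
  ... | u-blue , rest with ∧-true⁻ rest
  ... | allowed , only = inj₂ (u , u-blue , allowed , onlyWhite⇒ (iter Γ B F t) u w only)

  iter-keep : ∀ B F t w → lookup (iter Γ B F t) w ≡ true → lookup (iter Γ B F (suc t)) w ≡ true
  iter-keep B F t w blue = trans (lookup∘tabulate _ w) (∨-trueˡ _ blue)

  iter-force : ∀ B F t u w → lookup (iter Γ B F t) u ≡ true → F u w ≡ true →
               OnlyWhite (iter Γ B F t) u w → lookup (iter Γ B F (suc t)) w ≡ true
  iter-force B F t u w u-blue allowed only = trans (lookup∘tabulate _ w)
    (∨-trueʳ _ (any-true⁺ _ (∈-allFin u)
      (∧-true⁺ u-blue (∧-true⁺ allowed (⇒onlyWhite (iter Γ B F t) u w only)))))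

  Forces : (V Γ → ℕ) → V Γ → V Γ → Set
  Forces τ u v = τ u < τ v × arc Γ u v ≡ true × (∀ x → arc Γ u x ≡ true → x ≢ v → τ x < τ v)

  record Schedule (t : ℕ) : Set where
    field
      time     : V Γ → ℕ
      parent   : V Γ → V Γ
      within   : ∀ v → time v ≤ t
      forcedBy : ∀ v → 0 < time v → Forces time (parent v) v

  schedule : ∀ {t} (τ : V Γ → ℕ) → (∀ v → τ v ≤ t) →
             (∀ v → 0 < τ v → Σ (V Γ) λ u → Forces τ u v) → Schedule t
  schedule τ within forcer = record
    { time = τ ; parent = parent ; within = within ; forcedBy = forcedBy }
    where
    parent : V Γ → V Γ
    parent v with 0 ℕ.<? τ v
    ... | yes late = proj₁ (forcer v late)
    ... | no _     = v
    forcedBy : ∀ v → 0 < τ v → Forces τ (parent v) v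
    forcedBy v late with 0 ℕ.<? τ v
    ... | yes late′ = proj₂ (forcer v late′)
    ... | no early  = contradiction late early

  -- Distinct late vertices have distinct parents: if u forced both v and v′,
  -- each would have to turn blue before the other.
  parent-injective : ∀ {t} (σ : Schedule t) → let open Schedule σ in
    ∀ v v′ → 0 < time v → 0 < time v′ → parent v ≡ parent v′ → v ≡ v′
  parent-injective σ v v′ late late′ same with v ≟ᶠ v′
  ... | yes v≡v′ = v≡v′
  ... | no v≢v′  = contradiction (v-first v≢v′) (ℕ.<-asym (v′-first v≢v′))
    where
    open Schedule σ
    v′-first : v ≢ v′ → time v′ < time v
    v′-first v≢v′ = proj₂ (proj₂ (forcedBy v late)) v′
      (subst (λ u → arc Γ u v′ ≡ true) (sym same) (proj₁ (proj₂ (forcedBy v′ late′)))) (v≢v′ ∘ sym)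
    v-first : v ≢ v′ → time v < time v′
    v-first v≢v′ = proj₂ (proj₂ (forcedBy v′ late′)) v
      (subst (λ u → arc Γ u v ≡ true) same (proj₁ (proj₂ (forcedBy v late)))) v≢v′

  module FromRun (B : Subset (n Γ)) (F : V Γ → V Γ → Bool) (t : ℕ) (full : iter Γ B F t ≡ ⊤) where

    Blue : ℕ → V Γ → Set
    Blue s v = lookup (iter Γ B F s) v ≡ true

    entry : ∀ v → Least λ s → Blue s v
    entry v = least (λ s → lookup (iter Γ B F s) v Bool.≟ true) t (⊤⇒full full v)

    τ : V Γ → ℕ
    τ v = proj₁ (entry v)

    blue-at-entry : ∀ v → Blue (τ v) v
    blue-at-entry v = proj₁ (proj₂ (entry v))

    entry-first : ∀ v s → Blue s v → τ v ≤ s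
    entry-first v = proj₂ (proj₂ (entry v))

    -- A vertex entering at time s + 1 was forced in that round by a vertex
    -- that was blue at time s, as were all of that vertex's other out-neighbours.
    forcer : ∀ v s → τ v ≡ suc s → Σ (V Γ) λ u → Forces τ u v
    forcer v s entered with iter-suc⁻ B F s v (subst (λ r → Blue r v) entered (blue-at-entry v))
    ... | inj₁ v-blue = contradiction (subst (_≤ s) entered (entry-first v s v-blue)) (ℕ.<-irrefl refl)
    ... | inj₂ (u , u-blue , _ , arc-uv , _ , only) = u , earlier u u-blue , arc-uv , others
      where
      earlier : ∀ x → Blue s x → τ x < τ v
      earlier x x-blue = subst (τ x <_) (sym entered) (s≤s (entry-first x s x-blue))
      others : ∀ x → arc Γ u x ≡ true → x ≢ v → τ x < τ v
      others x arc-ux x≢v with true-or-false (lookup (iter Γ B F s) x)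
      ... | inj₁ x-blue  = earlier x x-blue
      ... | inj₂ x-white = contradiction (only x arc-ux x-white) x≢v

    late-forced : ∀ v → 0 < τ v → Σ (V Γ) λ u → Forces τ u v
    late-forced v late = forcer v (pred (τ v)) (sym (ℕ.suc-pred (τ v) {{>-nonZero late}}))

    initial-τ : initial τ ≡ B
    initial-τ = subset-ext (initial τ) B λ v → ⇔→≡ {z = true} (mk⇔
      (λ h → subst (λ r → Blue r v) (Equivalence.to (initial⇔ τ v) h) (blue-at-entry v))
      (λ h → Equivalence.from (initial⇔ τ v) (ℕ.n≤0⇒n≡0 (entry-first v 0 h))))

  scheduleOfRun : ∀ B F t → iter Γ B F t ≡ ⊤ → Σ (Schedule t) λ σ → initial (Schedule.time σ) ≡ B
  scheduleOfRun B F t full = schedule τ (λ v → entry-first v t (⊤⇒full full v)) late-forced , initial-τ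
    where open FromRun B F t full

  validSeq-++ : ∀ {S L T L′ U} → ValidSeq Γ S L T → ValidSeq Γ T L′ U → ValidSeq Γ S (L ++ L′) U
  validSeq-++ done                 rest = rest
  validSeq-++ (step u-blue only seq) rest = step u-blue only (validSeq-++ seq rest)

  -- Every schedule is carried out by an honest set of forces, its parent forces.
  module Realise {t : ℕ} (σ : Schedule t) where
    open Schedule σ

    parent-can-force : ∀ S w → 0 < time w → (∀ y → time y < time w → lookup S y ≡ true) →
                       lookup S w ≡ false → lookup S (parent w) ≡ true × OnlyWhite S (parent w) w
    parent-can-force S w late earlier-blue w-white with forcedBy w late
    ... | parent-first , arc-pw , others-first =
      earlier-blue (parent w) parent-first , arc-pw , w-white , others
      where
      others : ∀ y → arc Γ (parent w) y ≡ true → lookup S y ≡ false → y ≡ w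
      others y arc-y y-white with y ≟ᶠ w
      ... | yes y≡w = y≡w
      ... | no y≢w  = contradiction y-white (true≢false (earlier-blue y (others-first y arc-y y≢w)))

    scheduled-blue : ∀ F → (∀ v → 0 < time v → F (parent v) v ≡ true) →
                     ∀ s x → time x ≤ s → lookup (iter Γ (initial time) F s) x ≡ true
    scheduled-blue F allows zero x x≤0 = Equivalence.from (initial⇔ time x) (ℕ.n≤0⇒n≡0 x≤0)
    scheduled-blue F allows (suc s) x x≤s+1 with ℕ.m≤n⇒m<n∨m≡n x≤s+1
    ... | inj₁ x<s+1 = iter-keep _ F s x (scheduled-blue F allows s x (s≤s⁻¹ x<s+1))
    ... | inj₂ x≡s+1 with true-or-false (lookup (iter Γ (initial time) F s) x)
    ...   | inj₁ x-blue  = iter-keep _ F s x x-blue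
    ...   | inj₂ x-white =
      iter-force _ F s (parent x) x (proj₁ parent-forces) (allows x late) (proj₂ parent-forces)
      where
      blue-so-far : Subset (n Γ)
      blue-so-far = iter Γ (initial time) F s
      late : 0 < time x
      late = subst (0 <_) (sym x≡s+1) (s≤s z≤n)
      earlier-blue : ∀ y → time y < time x → lookup blue-so-far y ≡ true
      earlier-blue y y<x = scheduled-blue F allows s y (s≤s⁻¹ (subst (time y <_) x≡s+1 y<x))
      parent-forces : lookup blue-so-far (parent x) ≡ true × OnlyWhite blue-so-far (parent x) x
      parent-forces = parent-can-force blue-so-far x late earlier-blue x-white

    runOfSchedule : ∀ F → (∀ v → 0 < time v → F (parent v) v ≡ true) → iter Γ (initial time) F t ≡ ⊤
    runOfSchedule F allows = full⇒⊤ _ λ x → scheduled-blue F allows t x (within x)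

    parentArc : V Γ → V Γ → Bool
    parentArc u w = ⌊ (0 ℕ.<? time w) ×-dec (parent w ≟ᶠ u) ⌋

    parentArc⇔ : ∀ u w → parentArc u w ≡ true ⇔ (0 < time w × parent w ≡ u)
    parentArc⇔ u w = ⌊⌋-true⇔ ((0 ℕ.<? time w) ×-dec (parent w ≟ᶠ u))

    runOfParentArcs : iter Γ (initial time) parentArc t ≡ ⊤
    runOfParentArcs = runOfSchedule parentArc λ v late → Equivalence.from (parentArc⇔ (parent v) v) (late , refl)

    level : ℕ → List (V Γ)
    level s = filter (λ w → time w ℕ.≟ s) (allFin (n Γ))

    level⁻ : ∀ s {w} → w ∈ level s → time w ≡ s
    level⁻ s w∈level = proj₂ (∈-filter⁻ (λ w → time w ℕ.≟ s) {xs = allFin (n Γ)} w∈level)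

    level⁺ : ∀ s w → time w ≡ s → w ∈ level s
    level⁺ s w w-time = ∈-filter⁺ (λ w → time w ℕ.≟ s) (∈-allFin w) w-time

    parentForce : V Γ → V Γ × V Γ
    parentForce w = parent w , w

    chronicle : ℕ → List (V Γ × V Γ)
    chronicle zero    = []
    chronicle (suc s) = chronicle s ++ map parentForce (level (suc s))

    blueAfter : ℕ → Subset (n Γ)
    blueAfter zero    = initial time
    blueAfter (suc s) = addAll (blueAfter s) (level (suc s))

    blueAfter⁻ : ∀ s x → lookup (blueAfter s) x ≡ true → time x ≤ s
    blueAfter⁻ zero    x x-blue = ℕ.≤-reflexive (Equivalence.to (initial⇔ time x) x-blue)
    blueAfter⁻ (suc s) x x-blue with addAll⁻ (blueAfter s) (level (suc s)) x x-blue
    ... | inj₁ blue-before = ℕ.m≤n⇒m≤1+n (blueAfter⁻ s x blue-before)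
    ... | inj₂ x∈level     = ℕ.≤-reflexive (level⁻ (suc s) x∈level)

    blueAfter⁺ : ∀ s x → time x ≤ s → lookup (blueAfter s) x ≡ true
    blueAfter⁺ zero    x x≤0   = Equivalence.from (initial⇔ time x) (ℕ.n≤0⇒n≡0 x≤0)
    blueAfter⁺ (suc s) x x≤s+1 with ℕ.m≤n⇒m<n∨m≡n x≤s+1
    ... | inj₁ x<s+1 = addAll-old (blueAfter s) (level (suc s)) x (blueAfter⁺ s x (s≤s⁻¹ x<s+1))
    ... | inj₂ x≡s+1 = addAll-new (blueAfter s) (level (suc s)) x (level⁺ (suc s) x x≡s+1)

    force-level : ∀ s ws S → Unique ws → (∀ {w} → w ∈ ws → time w ≡ suc s) →
                  (∀ {w} → w ∈ ws → lookup S w ≡ false) → (∀ x → time x ≤ s → lookup S x ≡ true) →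
                  ValidSeq Γ S (map parentForce ws) (addAll S ws)
    force-level s []       S _                  _         _     _            = done
    force-level s (w ∷ ws) S (w∉ws ∷ distinct) w-times white earlier-blue =
      step (proj₁ forces) (⇒onlyWhite S (parent w) w (proj₂ forces))
        (force-level s ws (S ∪ ⁅ w ⁆) distinct (w-times ∘ there) still-white
          λ x x≤s → ∪⁅⁆-old S w x (earlier-blue x x≤s))
      where
      w-time : time w ≡ suc s
      w-time = w-times (here refl)
      forces : lookup S (parent w) ≡ true × OnlyWhite S (parent w) w
      forces = parent-can-force S w (subst (0 <_) (sym w-time) (s≤s z≤n))
        (λ y y<w → earlier-blue y (s≤s⁻¹ (subst (time y <_) w-time y<w))) (white (here refl))
      still-white : ∀ {w′} → w′ ∈ ws → lookup (S ∪ ⁅ w ⁆) w′ ≡ false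
      still-white {w′} w′∈ws with true-or-false (lookup (S ∪ ⁅ w ⁆) w′)
      ... | inj₂ w′-white = w′-white
      ... | inj₁ w′-blue with ∪⁅⁆⁻ S w w′ w′-blue
      ...   | inj₁ blue-before = contradiction (white (there w′∈ws)) (true≢false blue-before)
      ...   | inj₂ w′≡w        = contradiction (sym w′≡w) (All.lookup w∉ws w′∈ws)

    valid-chronicle : ∀ s → ValidSeq Γ (initial time) (chronicle s) (blueAfter s)
    valid-chronicle zero    = done
    valid-chronicle (suc s) = validSeq-++ (valid-chronicle s)
      (force-level s (level (suc s)) (blueAfter s)
        (Unique.filter⁺ (λ w → time w ℕ.≟ suc s) (Unique.allFin⁺ (n Γ)))
        (level⁻ (suc s)) new-white (blueAfter⁺ s))
      where
      new-white : ∀ {w} → w ∈ level (suc s) → lookup (blueAfter s) w ≡ false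
      new-white {w} w∈level with true-or-false (lookup (blueAfter s) w)
      ... | inj₂ w-white = w-white
      ... | inj₁ w-blue  = contradiction (subst (_≤ s) (level⁻ (suc s) w∈level) (blueAfter⁻ s w w-blue))
                                         (ℕ.<-irrefl refl)

    chronicle⁻ : ∀ s {u w} → (u , w) ∈ chronicle s → 0 < time w × parent w ≡ u
    chronicle⁻ (suc s) u,w∈ with ∈-++⁻ (chronicle s) u,w∈
    ... | inj₁ earlier = chronicle⁻ s earlier
    ... | inj₂ in-round with ∈-map⁻ parentForce in-round
    ...   | w , w∈level , refl = subst (0 <_) (sym (level⁻ (suc s) w∈level)) (s≤s z≤n) , refl

    chronicle⁺ : ∀ s w → 0 < time w → time w ≤ s → parentForce w ∈ chronicle s
    chronicle⁺ zero    w late w≤0   = contradiction (ℕ.≤-trans late w≤0) (ℕ.<-irrefl refl)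
    chronicle⁺ (suc s) w late w≤s+1 with ℕ.m≤n⇒m<n∨m≡n w≤s+1
    ... | inj₁ w<s+1 = ∈-++⁺ˡ (chronicle⁺ s w late (s≤s⁻¹ w<s+1))
    ... | inj₂ w≡s+1 = ∈-++⁺ʳ (chronicle s) (∈-map⁺ parentForce (level⁺ (suc s) w w≡s+1))

    forcesOfSchedule : IsForcesOf Γ (initial time) parentArc
    forcesOfSchedule = chronicle t , ⊤ ,
      subst (ValidSeq Γ (initial time) (chronicle t)) all-blue (valid-chronicle t) , stuck-⊤ , listed
      where
      all-blue : blueAfter t ≡ ⊤
      all-blue = full⇒⊤ (blueAfter t) λ x → blueAfter⁺ t x (within x)
      listed : ∀ u w → ((u , w) ∈ chronicle t) ⇔ (parentArc u w ≡ true)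
      listed u w = mk⇔ (λ u,w∈ → Equivalence.from (parentArc⇔ u w) (chronicle⁻ t u,w∈)) λ arc-uw →
        let late , parent≡u = Equivalence.to (parentArc⇔ u w) arc-uw
        in subst (λ p → (p , w) ∈ chronicle t) parent≡u (chronicle⁺ t w late (within w))

module Throttle (Γ : Digraph) where
  open Forcing Γ
  open Schedule

  allForces : V Γ → V Γ → Bool
  allForces _ _ = true

  Achievable : ℕ → Set
  Achievable k = Σ (Subset (n Γ)) λ B → Σ ℕ λ t → iter Γ B allForces t ≡ ⊤ × ∣ B ∣ + t ≡ k

  -- Only finitely many starts and at most k rounds need to be inspected.
  achievable? : ∀ k → Dec (Achievable k)
  achievable? k = map′ unbounded bounded
    (anySubset? λ B → ℕ.anyUpTo? (λ t → Vec.≡-dec Bool._≟_ (iter Γ B allForces t) ⊤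
                                          ×-dec (∣ B ∣ + t ℕ.≟ k)) (suc k))
    where
    unbounded : (Σ (Subset (n Γ)) λ B → ∃ λ t → t < suc k × iter Γ B allForces t ≡ ⊤ × ∣ B ∣ + t ≡ k) →
                Achievable k
    unbounded (B , t , _ , full , cost) = B , t , full , cost
    bounded : Achievable k →
              Σ (Subset (n Γ)) λ B → ∃ λ t → t < suc k × iter Γ B allForces t ≡ ⊤ × ∣ B ∣ + t ≡ k
    bounded (B , t , full , cost) = B , t , s≤s (subst (t ≤_) cost (ℕ.m≤n+m t ∣ B ∣)) , full , cost

  achievable-all : Achievable (n Γ)
  achievable-all = ⊤ , 0 , refl , trans (ℕ.+-identityʳ _) (∣⊤∣≡n (n Γ))

  schedule-achievable : ∀ {t} (σ : Schedule t) → Achievable (∣ initial (time σ) ∣ + t)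
  schedule-achievable {t} σ = initial (time σ) , t , Realise.runOfSchedule σ allForces (λ _ _ → refl) , refl

  run-achievable : ∀ B F t → iter Γ B F t ≡ ⊤ → Achievable (∣ B ∣ + t)
  run-achievable B F t full with scheduleOfRun B F t full
  ... | σ , initial≡B = subst (λ S → Achievable (∣ S ∣ + t)) initial≡B (schedule-achievable σ)

  Realised : ℕ → Set
  Realised k = Σ (Subset (n Γ)) λ B → Σ (V Γ → V Γ → Bool) λ F → Σ ℕ λ t →
    IsForcesOf Γ B F × iter Γ B F t ≡ ⊤ × ∣ B ∣ + t ≡ k

  achievable-realised : ∀ {k} → Achievable k → Realised k
  achievable-realised (B , t , full , cost) with scheduleOfRun B allForces t full
  ... | σ , refl = initial (time σ) , parentArc , t , forcesOfSchedule , runOfParentArcs , cost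
    where open Realise σ

  throttling : ∀ {k} → Achievable k → (∀ j → Achievable j → k ≤ j) → IsThrottling Γ k
  throttling achieved cheapest = achievable-realised achieved ,
    λ B F t _ full → cheapest (∣ B ∣ + t) (run-achievable B F t full)

onLeft : ∀ m {k} → Fin (m + k) → Bool
onLeft m v with splitAt m v
... | inj₁ _ = true
... | inj₂ _ = false

module _ {m k} (a : Fin m → Fin m → Bool) (b : Fin k → Fin k → Bool) where

  union-same-side : ∀ u v → unionArc a b u v ≡ true → onLeft m u ≡ onLeft m v
  union-same-side u v with splitAt m u | splitAt m v
  ... | inj₁ _ | inj₁ _ = λ _ → refl
  ... | inj₂ _ | inj₂ _ = λ _ → refl
  ... | inj₁ _ | inj₂ _ = λ ()
  ... | inj₂ _ | inj₁ _ = λ ()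

  union-reversed : ∀ u v → onLeft m u ≡ true → onLeft m v ≡ true →
                   unionArc (λ x y → a y x) b u v ≡ unionArc a b v u
  union-reversed u v with splitAt m u | splitAt m v
  ... | inj₁ _ | inj₁ _ = λ _ _ → refl
  ... | inj₁ _ | inj₂ _ = λ _ ()
  ... | inj₂ _ | _      = λ ()

  union-unchanged : ∀ u v → onLeft m u ≡ false → unionArc (λ x y → a y x) b u v ≡ unionArc a b u v
  union-unchanged u v with splitAt m u | splitAt m v
  ... | inj₁ _ | _      = λ ()
  ... | inj₂ _ | inj₁ _ = λ _ → refl
  ... | inj₂ _ | inj₂ _ = λ _ → refl

-- Every forcing chain
-- c₀ → c₁ → … → cᵣ of Γ₁ is run backwards: cᵢ is forced by cᵢ₊₁ at time
-- t + 1 − τ cᵢ₊₁, and the end cᵣ of the chain starts blue.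
module Transpose (Γ₁ Γ₂ : Digraph) {t : ℕ} (σ : Forcing.Schedule (Γ₁ ⊔ Γ₂) t) where
  open Forcing (Γ₁ ⊔ Γ₂) using (Forces; parent-injective)
  open Forcing ((Γ₁ ᵀ) ⊔ Γ₂) using () renaming (Forces to Forcesᵀ; Schedule to Scheduleᵀ; schedule to scheduleᵀ)
  open Forcing.Schedule σ

  Vertex : Set
  Vertex = Fin (n Γ₁ + n Γ₂)

  left : Vertex → Bool
  left = onLeft (n Γ₁)

  same-side : ∀ u v → arc (Γ₁ ⊔ Γ₂) u v ≡ true → left u ≡ left v
  same-side = union-same-side (arc Γ₁) (arc Γ₂)

  same-sideᵀ : ∀ u v → arc ((Γ₁ ᵀ) ⊔ Γ₂) u v ≡ true → left u ≡ left v
  same-sideᵀ = union-same-side (arc (Γ₁ ᵀ)) (arc Γ₂)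

  -- c is a child of v: a late vertex forced by v.  By parent-injective every
  -- vertex has at most one child.
  Child : Vertex → Vertex → Set
  Child v c = 0 < time c × parent c ≡ v

  child? : ∀ v → Dec (Σ Vertex (Child v))
  child? v = any? λ c → (0 ℕ.<? time c) ×-dec (parent c ≟ᶠ v)

  reversedTime : Vertex → ℕ
  reversedTime v with child? v
  ... | yes (c , _) = suc t ∸ time c
  ... | no _        = 0

  reversedTime-parent : ∀ c → 0 < time c → reversedTime (parent c) ≡ suc t ∸ time c
  reversedTime-parent c late with child? (parent c)
  ... | yes (c′ , late′ , same) = cong (λ x → suc t ∸ time x) (parent-injective σ c′ c late′ late same)
  ... | no childless            = contradiction (c , late , refl) childless

  reversedTime-late : ∀ v → 0 < reversedTime v → Σ Vertex (Child v)
  reversedTime-late v late with child? v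
  ... | yes has-child = has-child
  ... | no _          = contradiction late λ ()

  reversedTime-< : ∀ v b → 0 < b → (∀ c → Child v c → suc t ∸ time c < b) → reversedTime v < b
  reversedTime-< v b 0<b below with child? v
  ... | yes (c , child) = below c child
  ... | no _            = 0<b

  time′ : Vertex → ℕ
  time′ v = if left v then reversedTime v else time v

  time′-left : ∀ {v} → left v ≡ true → time′ v ≡ reversedTime v
  time′-left = Bool.if-cong

  time′-right : ∀ {v} → left v ≡ false → time′ v ≡ time v
  time′-right = Bool.if-cong

  within′ : ∀ v → time′ v ≤ t
  within′ v with left v
  ... | false = within v
  ... | true  = s≤s⁻¹ (reversedTime-< v (suc t) (s≤s z≤n) λ c (late , _) →
                  ℕ.∸-monoʳ-< late (ℕ.m≤n⇒m≤1+n (within c)))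

  earlier-than-children : ∀ x c → left x ≡ true →
    (∀ e → Child x e → time c < time e) → time′ x < suc t ∸ time c
  earlier-than-children x c x-left later = subst (_< suc t ∸ time c) (sym (time′-left x-left))
    (reversedTime-< x (suc t ∸ time c) (ℕ.m<n⇒0<n∸m (s≤s (within c))) λ e child →
      ℕ.∸-monoʳ-< (later e child) (ℕ.m≤n⇒m≤1+n (within e)))

  forced-right : ∀ v → left v ≡ false → 0 < time v → Forcesᵀ time′ (parent v) v
  forced-right v v-right late = first , arcᵀ-uv , others
    where
    forcing : Forces time (parent v) v
    forcing = forcedBy v late
    u-right : left (parent v) ≡ false
    u-right = trans (same-side (parent v) v (proj₁ (proj₂ forcing))) v-right
    unchanged : ∀ x → arc ((Γ₁ ᵀ) ⊔ Γ₂) (parent v) x ≡ arc (Γ₁ ⊔ Γ₂) (parent v) x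
    unchanged x = union-unchanged (arc Γ₁) (arc Γ₂) (parent v) x u-right
    right-time : ∀ x → arc (Γ₁ ⊔ Γ₂) (parent v) x ≡ true → time′ x ≡ time x
    right-time x arc-ux = time′-right (trans (sym (same-side (parent v) x arc-ux)) u-right)
    first : time′ (parent v) < time′ v
    first = subst₂ _<_ (sym (time′-right u-right)) (sym (time′-right v-right)) (proj₁ forcing)
    arcᵀ-uv : arc ((Γ₁ ᵀ) ⊔ Γ₂) (parent v) v ≡ true
    arcᵀ-uv = trans (unchanged v) (proj₁ (proj₂ forcing))
    others : ∀ x → arc ((Γ₁ ᵀ) ⊔ Γ₂) (parent v) x ≡ true → x ≢ v → time′ x < time′ v
    others x arcᵀ-ux x≢v = subst₂ _<_ (sym (right-time x arc-ux)) (sym (time′-right v-right))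
                             (proj₂ (proj₂ forcing) x arc-ux x≢v)
      where
      arc-ux : arc (Γ₁ ⊔ Γ₂) (parent v) x ≡ true
      arc-ux = trans (sym (unchanged x)) arcᵀ-ux

  -- On the left component the roles are swapped: the old child c of a vertex
  -- now forces it.  Every other in-neighbour x of c forced its children after
  -- c turned blue, so x is earlier than parent c in the new times.
  forced-left : ∀ c → 0 < time c → left (parent c) ≡ true → Forcesᵀ time′ c (parent c)
  forced-left c late parent-left = new-time c-first , arcᵀ-cp , others
    where
    forcing : Forces time (parent c) c
    forcing = forcedBy c late
    new-time : ∀ {a} → a < suc t ∸ time c → a < time′ (parent c)
    new-time = subst (_ <_) (sym (trans (time′-left parent-left) (reversedTime-parent c late)))
    c-left : left c ≡ true
    c-left = trans (sym (same-side (parent c) c (proj₁ (proj₂ forcing)))) parent-left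
    reversed : ∀ x → left x ≡ true → arc ((Γ₁ ᵀ) ⊔ Γ₂) c x ≡ arc (Γ₁ ⊔ Γ₂) x c
    reversed x x-left = union-reversed (arc Γ₁) (arc Γ₂) c x c-left x-left
    c-first : time′ c < suc t ∸ time c
    c-first = earlier-than-children c c c-left λ e (late-e , parent-e) →
      subst (λ y → time y < time e) parent-e (proj₁ (forcedBy e late-e))
    arcᵀ-cp : arc ((Γ₁ ᵀ) ⊔ Γ₂) c (parent c) ≡ true
    arcᵀ-cp = trans (reversed (parent c) parent-left) (proj₁ (proj₂ forcing))
    c-before : ∀ x → arc (Γ₁ ⊔ Γ₂) x c ≡ true → x ≢ parent c → ∀ e → Child x e → time c < time e
    c-before x arc-xc x≢parent e (late-e , parent-e) = proj₂ (proj₂ (forcedBy e late-e)) c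
      (subst (λ y → arc (Γ₁ ⊔ Γ₂) y c ≡ true) (sym parent-e) arc-xc)
      λ c≡e → x≢parent (trans (sym parent-e) (cong parent (sym c≡e)))
    others : ∀ x → arc ((Γ₁ ᵀ) ⊔ Γ₂) c x ≡ true → x ≢ parent c → time′ x < time′ (parent c)
    others x arcᵀ-cx x≢parent = new-time (earlier-than-children x c x-left (c-before x arc-xc x≢parent))
      where
      x-left : left x ≡ true
      x-left = trans (sym (same-sideᵀ c x arcᵀ-cx)) c-left
      arc-xc : arc (Γ₁ ⊔ Γ₂) x c ≡ true
      arc-xc = trans (sym (reversed x x-left)) arcᵀ-cx

  forcer′ : ∀ v → 0 < time′ v → Σ Vertex λ u → Forcesᵀ time′ u v
  forcer′ v late′ with true-or-false (left v)
  ... | inj₂ v-right = parent v , forced-right v v-right (subst (0 <_) (time′-right v-right) late′)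
  ... | inj₁ v-left with reversedTime-late v (subst (0 <_) (time′-left v-left) late′)
  ...   | c , late , refl = c , forced-left c late v-left

  transposed : Scheduleᵀ t
  transposed = scheduleᵀ time′ within′ forcer′

  parent-side : ∀ x → 0 < time x → left (parent x) ≡ left x
  parent-side x late = same-side (parent x) x (proj₁ (proj₂ (forcedBy x late)))

  -- Old late vertices go injectively to new late vertices: a left vertex to
  -- its parent (which it now forces), a right vertex to itself.
  partner : Vertex → Vertex
  partner x = if left x then parent x else x

  partner-late : ∀ x → 0 < time x → 0 < time′ (partner x)
  partner-late x late with left x in x-side
  ... | false = subst (0 <_) (sym (time′-right x-side)) late
  ... | true  = subst (0 <_) (sym (trans (time′-left (trans (parent-side x late) x-side))
                                         (reversedTime-parent x late)))
                  (ℕ.m<n⇒0<n∸m (s≤s (within x)))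

  partner-injective : ∀ x y → 0 < time x → 0 < time y → partner x ≡ partner y → x ≡ y
  partner-injective x y late-x late-y same with left x in x-side | left y in y-side
  ... | true  | true  = parent-injective σ x y late-x late-y same
  ... | false | false = same
  ... | true  | false = contradiction y-side
                          (true≢false (trans (cong left (sym same)) (trans (parent-side x late-x) x-side)))
  ... | false | true  = contradiction x-side
                          (true≢false (trans (cong left same) (trans (parent-side y late-y) y-side)))

  fewer-blue : ∣ initial time′ ∣ ≤ ∣ initial time ∣
  fewer-blue = fewer-initial time time′ partner partner-late partner-injective

transpose-achievable : ∀ Γ₁ Γ₂ {k} → Throttle.Achievable (Γ₁ ⊔ Γ₂) k →
                       Σ ℕ λ k′ → k′ ≤ k × Throttle.Achievable ((Γ₁ ᵀ) ⊔ Γ₂) k′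
transpose-achievable Γ₁ Γ₂ (B , t , full , cost) with Forcing.scheduleOfRun (Γ₁ ⊔ Γ₂) B _ t full
... | σ , refl = ∣ initial time′ ∣ + t , subst (∣ initial time′ ∣ + t ≤_) cost (ℕ.+-monoˡ-≤ t fewer-blue) ,
                 Throttle.schedule-achievable ((Γ₁ ᵀ) ⊔ Γ₂) transposed
  where open Transpose Γ₁ Γ₂ σ

-- th(Γ₁ ⊔ Γ₂) = th(Γ₁ᵀ ⊔ Γ₂): let k be the least achievable cost of Γ₁ ⊔ Γ₂.
-- Transposing Γ₁ achieves some k′ ≤ k, and transposing back (Γ₁ᵀᵀ = Γ₁)
-- shows that no cost below k is achievable for Γ₁ᵀ ⊔ Γ₂.
theorem2p15 : (Γ₁ Γ₂ : Digraph) →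
    Σ ℕ λ k → IsThrottling (Γ₁ ⊔ Γ₂) k × IsThrottling ((Γ₁ ᵀ) ⊔ Γ₂) k
theorem2p15 Γ₁ Γ₂ = k , U.throttling achieved cheapest , Uᵀ.throttling achievedᵀ cheapestᵀ
  where
  module U  = Throttle (Γ₁ ⊔ Γ₂)
  module Uᵀ = Throttle ((Γ₁ ᵀ) ⊔ Γ₂)
  cheapest-cost : Least U.Achievable
  cheapest-cost = least U.achievable? (n (Γ₁ ⊔ Γ₂)) U.achievable-all
  k : ℕ
  k = proj₁ cheapest-cost
  achieved : U.Achievable k
  achieved = proj₁ (proj₂ cheapest-cost)
  cheapest : ∀ j → U.Achievable j → k ≤ j
  cheapest = proj₂ (proj₂ cheapest-cost)
  cheapestᵀ : ∀ j → Uᵀ.Achievable j → k ≤ j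
  cheapestᵀ j achieved-j with transpose-achievable (Γ₁ ᵀ) Γ₂ achieved-j
  ... | j′ , j′≤j , achieved-j′ = ℕ.≤-trans (cheapest j′ achieved-j′) j′≤j
  achievedᵀ : Uᵀ.Achievable k
  achievedᵀ with transpose-achievable Γ₁ Γ₂ achieved
  ... | k′ , k′≤k , achieved-k′ =
    subst Uᵀ.Achievable (ℕ.≤-antisym k′≤k (cheapestᵀ k′ achieved-k′)) achieved-k′
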